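{- Let $p\geq3$ be a prime and let $A\in\mathbb{Z}_p$ be written as $A=\sum_{i=0}^{\infty}a_ip^i=\sum_{j=0}^{\infty}b_jp^j$ with $a_i\in\{0,\pm1,\ldots,\pm\frac{p-1}{2}\}$ and $b_j\in\{0,1,\ldots,p-1\}$. Then for every $t\geq0$, $$b_t\equiv a_t+f_t(a_0,\ldots,a_{t-1})\pmod p,\qquad a_t\equiv b_t+g_t(b_0,\ldots,b_{t-1})\pmod p.$$
   Context: Define $$f_t(x_0,\ldots,x_{t-1})=\sum_{\lambda=0}^{t-1}\Bigl\{\sum_{c=1}^{\frac{p-1}{2}}\bigl[(x_\lambda+c)^{p-1}-1\bigr]\Bigr\}\prod_{\lambda<i<t}(1-x_i^{p-1}),$$ $$g_t(y_0,\ldots,y_{t-1})=\sum_{\lambda=0}^{t-1}\Bigl\{\sum_{c=\frac{p+1}{2}}^{p-1}\bigl[1-(y_\lambda-c)^{p-1}\bigr]\Bigr\}\prod_{\lambda<i<t}\Bigl[1-\bigl(y_i-\tfrac{p-1}{2}\bigr)^{p-1}\Bigr],$$ with the conventions that an empty product is $1$ and an empty sum is $0$ (so $f_0=g_0=0$). -}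

module Defs where

open import Data.Nat as ℕ using (ℕ; zero; suc; _∸_)
open import Data.Nat.DivMod using (_/_)
open import Data.Integer using (ℤ; +_; _+_; _-_; _*_; _^_; 0ℤ; 1ℤ)
open import Data.Integer.Divisibility using (_∣_)

sumℤ : ℕ → (ℕ → ℤ) → ℤ
sumℤ zero    F = 0ℤ
sumℤ (suc n) F = sumℤ n F + F n

prodℤ : ℕ → (ℕ → ℤ) → ℤ
prodℤ zero    F = 1ℤ
prodℤ (suc n) F = prodℤ n F * F n

-- Σ_{c=lo}^{hi} F c  (inclusive; empty if hi < lo)
sumFromTo : ℕ → ℕ → (ℕ → ℤ) → ℤ
sumFromTo lo hi F = sumℤ (suc hi ∸ lo) (λ k → F (lo ℕ.+ k))

prodBetween : ℕ → ℕ → (ℕ → ℤ) → ℤ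
prodBetween lo hi F = prodℤ (hi ∸ suc lo) (λ k → F (suc lo ℕ.+ k))

half : ℕ → ℕ
half p = (p ∸ 1) / 2

_≡_[mod_] : ℤ → ℤ → ℤ → Set
x ≡ y [mod m ] = m ∣ (x - y)

f : (p t : ℕ) → (ℕ → ℤ) → ℤ
f p t x = sumℤ t (λ λ′ →
    sumFromTo 1 (half p) (λ c → (x λ′ + + c) ^ (p ∸ 1) - 1ℤ)
  * prodBetween λ′ t (λ i → 1ℤ - x i ^ (p ∸ 1)))

g : (p t : ℕ) → (ℕ → ℤ) → ℤ
g p t y = sumℤ t (λ λ′ →
    sumFromTo (suc (half p)) (p ∸ 1) (λ c → 1ℤ - (y λ′ - + c) ^ (p ∸ 1))
  * prodBetween λ′ t (λ i → 1ℤ - (y i - + half p) ^ (p ∸ 1)))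

-- The element of ℤ_p with digit sequences a (balanced) and b (standard):
-- the two p-adic series define the same p-adic integer iff all partial
-- sums agree modulo p^n.
SameP-adic : (p : ℕ) → (ℕ → ℤ) → (ℕ → ℤ) → Set
SameP-adic p a b = ∀ n →
  sumℤ n (λ i → a i * (+ p) ^ i) ≡ sumℤ n (λ j → b j * (+ p) ^ j) [mod (+ p) ^ n ]

-- Write p = 2h + 1. Rewriting balanced digits a as standard digits is carrying: b_t = a_t + c_t − p c_{t+1}
-- with borrows c_t ∈ {0, −1}, c_{t+1} = −1 exactly when a_t < 0, or a_t = 0 and c_t = −1; conversely
-- a_t = b_t + c_t − p c_{t+1} with carries c_t ∈ {0, 1}. These digits are forced, because two digit sequences of
-- the same p-adic integer whose digits differ by less than p coincide. By Fermat, z^(p−1) ≡ 1 for 0 < |z| < p,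
-- so modulo p the products in f_t become the indicators [a_i = 0] and the inner sums −[a_λ < 0]; hence f_t
-- satisfies the same recurrence c_{t+1} ≡ c_t [a_t = 0] − [a_t < 0] as the borrows and f_t ≡ c_t. Likewise
-- g_t ≡ c_t for the carries, whose recurrence is c_{t+1} = c_t [b_t = h] + [b_t > h].

module Submission where

open import Defs
open import Data.Nat as ℕ using (ℕ; zero; suc; _≤_; _<_; z≤n; s≤s; _∸_)
import Data.Nat.Properties as ℕ
open import Data.Integer as ℤ using (ℤ; +_; -[1+_]; +[1+_]; ∣_∣; _+_; _-_; _*_; -_; _^_; 0ℤ; 1ℤ; -1ℤ)
import Data.Integer.Properties as ℤ
open import Data.Integer.Divisibility.Signed as ∣ using (∣ᵤ⇒∣; ∣⇒∣ᵤ) renaming (_∣_ to _∣ˢ_)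
open import Data.Integer.Tactic.RingSolver using (solve-∀)
open import Data.Nat.Combinatorics using (_C_; nC1≡n; nCn≡1; nCk+nC[k+1]≡[n+1]C[k+1])
open import Data.Nat.Combinatorics.Specification using (k>n⇒nCk≡0)
import Data.Nat.Divisibility as ℕ
open import Data.Nat.Primality using (Prime; euclidsLemma; prime⇒nonZero; prime⇒nonTrivial; prime⇒irreducible)
import Data.Nat.Tactic.RingSolver as ℕ-Solver
open import Data.Fin as Fin using (toℕ; inject₁; fromℕ)
import Data.Fin.Properties as Fin
open import Data.Vec.Functional using (Vector; init; last; tail)
open import Algebra.Properties.CommutativeSemiring.Binomial ℤ.+-*-commutativeSemiring
  using (binomialExpansion; binomialTerm) renaming (theorem to binomial-theorem)
open import Algebra.Properties.Monoid.Sum ℤ.+-0-monoid using (sum; sum-init-last)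
import Algebra.Definitions.RawSemiring ℤ.+-*-rawSemiring as Semiring
open import Data.Sum using (_⊎_; inj₁; inj₂)
open import Data.Product using (_×_; _,_; ∃-syntax)
open import Data.Empty using (⊥-elim)
open import Function using (_∘_)
open import Data.Nat.Induction using (<-rec)
open import Data.Nat.DivMod using (_%_; _/_; m*n/n≡m; m%n<n; m≡m%n+[m/n]*n)
open import Relation.Binary.Bundles using (Setoid)
open import Relation.Binary.Structures using (IsEquivalence)
open import Relation.Binary.Definitions using (tri<; tri≈; tri>)
open import Relation.Binary.PropositionalEquality
open import Relation.Nullary using (¬_; yes; no; contradiction)

sumℤ-cong : ∀ n {F G : ℕ → ℤ} → (∀ k → k < n → F k ≡ G k) → sumℤ n F ≡ sumℤ n G
sumℤ-cong zero    F≡G = refl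
sumℤ-cong (suc n) F≡G = cong₂ _+_ (sumℤ-cong n (λ k k<n → F≡G k (ℕ.m<n⇒m<1+n k<n))) (F≡G n ℕ.≤-refl)

sumℤ-*ʳ : ∀ n c (F : ℕ → ℤ) → sumℤ n (λ k → F k * c) ≡ sumℤ n F * c
sumℤ-*ʳ zero    c F = sym (ℤ.*-zeroˡ c)
sumℤ-*ʳ (suc n) c F = trans (cong (_+ F n * c) (sumℤ-*ʳ n c F)) (sym (ℤ.*-distribʳ-+ c (sumℤ n F) (F n)))

prodBetween-last : ∀ (Q : ℕ → ℤ) {l t} → l < t → prodBetween l (suc t) Q ≡ prodBetween l t Q * Q t
prodBetween-last Q {l} {t} l<t =
  trans (cong (λ n → prodℤ n (λ k → Q (suc l ℕ.+ k))) (ℕ.+-∸-assoc 1 l<t))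
        (cong (prodBetween l t Q *_) (cong Q (ℕ.m+[n∸m]≡n l<t)))

prodBetween-empty : ∀ (Q : ℕ → ℤ) t → prodBetween t (suc t) Q ≡ 1ℤ
prodBetween-empty Q t = cong (λ n → prodℤ n (λ k → Q (suc t ℕ.+ k))) (ℕ.n∸n≡0 t)

-- The value after t steps of c ↦ c * Q i + F i, started at c = 0.
iterAffine : ℕ → (ℕ → ℤ) → (ℕ → ℤ) → ℤ
iterAffine t F Q = sumℤ t (λ l → F l * prodBetween l t Q)

iterAffine-suc : ∀ t F Q → iterAffine (suc t) F Q ≡ iterAffine t F Q * Q t + F t
iterAffine-suc t F Q = cong₂ _+_
  (trans (sumℤ-cong t (λ l l<t → trans (cong (F l *_) (prodBetween-last Q l<t)) (sym (ℤ.*-assoc (F l) _ _))))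
         (sumℤ-*ʳ t (Q t) (λ l → F l * prodBetween l t Q)))
  (trans (cong (F t *_) (prodBetween-empty Q t)) (ℤ.*-identityʳ (F t)))

module Congruence (m : ℤ) where

  infix 4 _≈_
  record _≈_ (x y : ℤ) : Set where
    constructor mod
    field divides : m ∣ˢ x - y

  ≈-reflexive : ∀ {x y} → x ≡ y → x ≈ y
  ≈-reflexive {x} refl = mod (∣.divides 0ℤ (ℤ.+-inverseʳ x))

  ≈-refl : ∀ {x} → x ≈ x
  ≈-refl = ≈-reflexive refl

  ≈-sym : ∀ {x y} → x ≈ y → y ≈ x
  ≈-sym {x} {y} (mod d) = mod (subst (m ∣ˢ_) (negate x y) (∣.∣m⇒∣-m d))
    where negate : ∀ x y → - (x - y) ≡ y - x
          negate = solve-∀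

  ≈-trans : ∀ {x y z} → x ≈ y → y ≈ z → x ≈ z
  ≈-trans {x} {y} {z} (mod d) (mod e) = mod (subst (m ∣ˢ_) (telescope x y z) (∣.∣m∣n⇒∣m+n d e))
    where telescope : ∀ x y z → (x - y) + (y - z) ≡ x - z
          telescope = solve-∀

  ≈-isEquivalence : IsEquivalence _≈_
  ≈-isEquivalence = record { refl = ≈-refl ; sym = ≈-sym ; trans = ≈-trans }

  ≈-setoid : Setoid _ _
  ≈-setoid = record { isEquivalence = ≈-isEquivalence }

  +-cong : ∀ {x y u v} → x ≈ y → u ≈ v → x + u ≈ y + v
  +-cong {x} {y} {u} {v} (mod d) (mod e) = mod (subst (m ∣ˢ_) (regroup x y u v) (∣.∣m∣n⇒∣m+n d e))
    where regroup : ∀ x y u v → (x - y) + (u - v) ≡ (x + u) - (y + v)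
          regroup = solve-∀

  -‿cong : ∀ {x y} → x ≈ y → - x ≈ - y
  -‿cong {x} {y} (mod d) = mod (subst (m ∣ˢ_) (negate x y) (∣.∣m⇒∣-m d))
    where negate : ∀ x y → - (x - y) ≡ - x - - y
          negate = solve-∀

  *-cong : ∀ {x y u v} → x ≈ y → u ≈ v → x * u ≈ y * v
  *-cong {x} {y} {u} {v} (mod d) (mod e) =
    mod (subst (m ∣ˢ_) (regroup x y u v) (∣.∣m∣n⇒∣m+n (∣.∣m⇒∣m*n u d) (∣.∣n⇒∣m*n y e)))
    where regroup : ∀ x y u v → (x - y) * u + y * (u - v) ≡ x * u - y * v
          regroup = solve-∀

  -multiple : ∀ x y → x - m * y ≈ x
  -multiple x y = mod (subst (m ∣ˢ_) (cancel x y m) (∣.∣m⇒∣-m (∣.∣n⇒∣m*n y ∣.∣-refl)))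
    where cancel : ∀ x y m → - (y * m) ≡ (x - m * y) - x
          cancel = solve-∀

  +-cancelˡ : ∀ {x y z} → x + y ≈ x + z → y ≈ z
  +-cancelˡ {x} {y} {z} (mod d) = mod (subst (m ∣ˢ_) (cancel x y z) d)
    where cancel : ∀ x y z → (x + y) - (x + z) ≡ y - z
          cancel = solve-∀

  ≈⇒≡[mod] : ∀ {x y} → x ≈ y → x ≡ y [mod m ]
  ≈⇒≡[mod] (mod d) = ∣⇒∣ᵤ d

  sumℤ-≈-0 : ∀ n {F : ℕ → ℤ} → (∀ k → k < n → F k ≈ 0ℤ) → sumℤ n F ≈ 0ℤ
  sumℤ-≈-0 zero    F≈0 = ≈-refl
  sumℤ-≈-0 (suc n) F≈0 = +-cong (sumℤ-≈-0 n (λ k k<n → F≈0 k (ℕ.m<n⇒m<1+n k<n))) (F≈0 n ℕ.≤-refl)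

  sumℤ-≈-single : ∀ n {F : ℕ → ℤ} {j v} → j < n → F j ≈ v → (∀ k → k < n → k ≢ j → F k ≈ 0ℤ) →
                  sumℤ n F ≈ v
  sumℤ-≈-single (suc n) {F} {j} {v} j<1+n Fj≈v F≈0 with j ℕ.≟ n
  ... | yes refl = ≈-trans (+-cong (sumℤ-≈-0 n (λ k k<n → F≈0 k (ℕ.m<n⇒m<1+n k<n) (ℕ.<⇒≢ k<n))) Fj≈v)
                           (≈-reflexive (ℤ.+-identityˡ v))
  ... | no j≢n  = ≈-trans (+-cong (sumℤ-≈-single n (ℕ.≤∧≢⇒< (ℕ.≤-pred j<1+n) j≢n) Fj≈v
                                     (λ k k<n → F≈0 k (ℕ.m<n⇒m<1+n k<n)))
                                  (F≈0 n ℕ.≤-refl (≢-sym j≢n)))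
                          (≈-reflexive (ℤ.+-identityʳ v))

  iterAffine-≈ : ∀ (c F Q : ℕ → ℤ) → c 0 ≡ 0ℤ → (∀ t → c (suc t) ≈ c t * Q t + F t) →
                 ∀ t → iterAffine t F Q ≈ c t
  iterAffine-≈ c F Q c₀ step zero    = ≈-reflexive (sym c₀)
  iterAffine-≈ c F Q c₀ step (suc t) = ≈-trans (≈-reflexive (iterAffine-suc t F Q))
    (≈-trans (+-cong (*-cong (iterAffine-≈ c F Q c₀ step t) ≈-refl) ≈-refl) (≈-sym (step t)))

-- Fermat's little theorem

[k+1]*[n+1]C[k+1]≡[n+1]*nCk : ∀ n k → suc k ℕ.* (suc n C suc k) ≡ suc n ℕ.* (n C k)
[k+1]*[n+1]C[k+1]≡[n+1]*nCk zero    zero    = refl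
[k+1]*[n+1]C[k+1]≡[n+1]*nCk zero    (suc k) =
  trans (cong (suc (suc k) ℕ.*_) (k>n⇒nCk≡0 {1} (s≤s (s≤s (z≤n {k})))))
                                     (ℕ.*-zeroʳ (suc (suc k)))
[k+1]*[n+1]C[k+1]≡[n+1]*nCk (suc n) zero    =
  trans (ℕ.*-identityˡ _) (trans (nC1≡n (suc (suc n))) (sym (ℕ.*-identityʳ _)))
[k+1]*[n+1]C[k+1]≡[n+1]*nCk (suc n) (suc k) = begin
  suc (suc k) ℕ.* (suc (suc n) C suc (suc k))
    ≡⟨ cong (suc (suc k) ℕ.*_) (sym (nCk+nC[k+1]≡[n+1]C[k+1] (suc n) (suc k))) ⟩
  suc (suc k) ℕ.* (X ℕ.+ Y)
    ≡⟨ rearrange k X Y ⟩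
  suc k ℕ.* X ℕ.+ suc (suc k) ℕ.* Y ℕ.+ X
    ≡⟨ cong₂ (λ u v → u ℕ.+ v ℕ.+ X) ([k+1]*[n+1]C[k+1]≡[n+1]*nCk n k)
                                     ([k+1]*[n+1]C[k+1]≡[n+1]*nCk n (suc k)) ⟩
  suc n ℕ.* (n C k) ℕ.+ suc n ℕ.* (n C suc k) ℕ.+ X
    ≡⟨ cong (ℕ._+ X) (sym (ℕ.*-distribˡ-+ (suc n) (n C k) (n C suc k))) ⟩
  suc n ℕ.* (n C k ℕ.+ n C suc k) ℕ.+ X
    ≡⟨ cong (λ u → suc n ℕ.* u ℕ.+ X) (nCk+nC[k+1]≡[n+1]C[k+1] n k) ⟩
  suc n ℕ.* X ℕ.+ X
    ≡⟨ ℕ.+-comm (suc n ℕ.* X) X ⟩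
  suc (suc n) ℕ.* X ∎
  where
  open ≡-Reasoning
  X = suc n C suc k
  Y = suc n C suc (suc k)
  rearrange : ∀ k X Y → suc (suc k) ℕ.* (X ℕ.+ Y) ≡ suc k ℕ.* X ℕ.+ suc (suc k) ℕ.* Y ℕ.+ X
  rearrange = ℕ-Solver.solve-∀

p∣pCk : ∀ {p k} → Prime p → 0 < k → k < p → p ℕ.∣ p C k
p∣pCk {suc n} {suc k} isPrime _ k<p
  with euclidsLemma (suc k) (suc n C suc k) isPrime
         (subst (suc n ℕ.∣_) (sym ([k+1]*[n+1]C[k+1]≡[n+1]*nCk n k)) (ℕ.m∣m*n (n C k)))
... | inj₁ p∣k = ⊥-elim (ℕ.<⇒≱ k<p (ℕ.∣⇒≤ p∣k))
... | inj₂ p∣C = p∣C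

×≡* : ∀ n z → n Semiring.× z ≡ + n * z
×≡* zero    z = sym (ℤ.*-zeroˡ z)
×≡* (suc n) z = trans (cong (λ w → z + w) (×≡* n z)) (sym (ℤ.suc-* (+ n) z))

^≡^ : ∀ z n → z Semiring.^ n ≡ z ^ n
^≡^ z zero    = refl
^≡^ z (suc n) = cong (z *_) (^≡^ z n)

∣-sum : ∀ {k n} (t : Vector ℤ n) → (∀ i → k ∣ˢ t i) → k ∣ˢ sum t
∣-sum {n = zero}  t k∣t = ∣ᵤ⇒∣ (_ ℕ.∣0)
∣-sum {n = suc n} t k∣t = ∣.∣m∣n⇒∣m+n (k∣t Fin.zero) (∣-sum (tail t) (k∣t ∘ Fin.suc))

-- Every binomial coefficient strictly between the two outer ones is divisible by p.
freshmans-dream : ∀ {p} → Prime p → ∀ x → + p ∣ˢ (1ℤ + x) ^ p - (1ℤ + x ^ p)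
freshmans-dream {zero}  isPrime x = contradiction refl (ℕ.≢-nonZero⁻¹ 0 {{prime⇒nonZero isPrime}})
freshmans-dream {suc m} isPrime x = subst (+ p ∣ˢ_) inner≡ (∣-sum (init (tail term)) inner-divisible)
  where
  open ≡-Reasoning
  p = suc m
  term : Vector ℤ (suc p)
  term = binomialTerm 1ℤ x p
  term-first : term Fin.zero ≡ x ^ p
  term-first = trans (×≡* 1 _) (trans (ℤ.*-identityˡ _) (trans (ℤ.*-identityˡ _) (^≡^ x p)))
  term-last : last (tail term) ≡ 1ℤ
  term-last = begin
    (p C toℕ (fromℕ p)) Semiring.× (1ℤ Semiring.^ toℕ (fromℕ p) * x Semiring.^ (p ∸ toℕ (fromℕ p)))
      ≡⟨ cong (λ k → (p C k) Semiring.× (1ℤ Semiring.^ k * x Semiring.^ (p ∸ k))) (Fin.toℕ-fromℕ p) ⟩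
    (p C p) Semiring.× (1ℤ Semiring.^ p * x Semiring.^ (p ∸ p))
      ≡⟨ cong₂ (λ c k → c Semiring.× (1ℤ Semiring.^ p * x Semiring.^ k)) (nCn≡1 p) (ℕ.n∸n≡0 p) ⟩
    1ℤ Semiring.^ p * 1ℤ + 0ℤ
      ≡⟨ trans (ℤ.+-identityʳ _) (trans (ℤ.*-identityʳ _) (trans (^≡^ 1ℤ p) (ℤ.^-zeroˡ p))) ⟩
    1ℤ ∎
  inner-divisible : ∀ i → + p ∣ˢ init (tail term) i
  inner-divisible i = subst (+ p ∣ˢ_) (sym (×≡* (p C suc j) _))
    (∣.∣m⇒∣m*n {m = + (p C suc j)} (1ℤ Semiring.^ suc j * x Semiring.^ (p ∸ suc j))
      (∣ᵤ⇒∣ (p∣pCk isPrime (s≤s z≤n) (s≤s j<m))))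
    where
    j = toℕ (inject₁ i)
    j<m : j < m
    j<m = subst (_< m) (sym (Fin.toℕ-inject₁ i)) (Fin.toℕ<n i)
  inner≡ : sum (init (tail term)) ≡ (1ℤ + x) ^ p - (1ℤ + x ^ p)
  inner≡ = begin
    sum (init (tail term))
      ≡⟨ cancel (sum (init (tail term))) (x ^ p) ⟩
    (x ^ p + (sum (init (tail term)) + 1ℤ)) - (1ℤ + x ^ p)
      ≡⟨ cong₂ (λ u w → (u + (sum (init (tail term)) + w)) - (1ℤ + x ^ p)) (sym term-first) (sym term-last) ⟩
    (term Fin.zero + (sum (init (tail term)) + last (tail term))) - (1ℤ + x ^ p)
      ≡⟨ cong (λ w → (term Fin.zero + w) - (1ℤ + x ^ p)) (sym (sum-init-last (tail term))) ⟩
    binomialExpansion 1ℤ x p - (1ℤ + x ^ p)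
      ≡⟨ cong (_- (1ℤ + x ^ p)) (sym (binomial-theorem p 1ℤ x)) ⟩
    (1ℤ + x) Semiring.^ p - (1ℤ + x ^ p)
      ≡⟨ cong (_- (1ℤ + x ^ p)) (^≡^ (1ℤ + x) p) ⟩
    (1ℤ + x) ^ p - (1ℤ + x ^ p) ∎
    where
    cancel : ∀ s y → s ≡ (y + (s + 1ℤ)) - (1ℤ + y)
    cancel = solve-∀

∣i∣<p∧p∣i⇒i≡0 : ∀ {p i} → ∣ i ∣ < p → + p ∣ˢ i → i ≡ 0ℤ
∣i∣<p∧p∣i⇒i≡0 {p} {i} ∣i∣<p p∣i with ∣ i ∣ in ∣i∣≡ | ∣⇒∣ᵤ p∣i
... | zero  | _   = ℤ.∣i∣≡0⇒i≡0 ∣i∣≡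
... | suc n | p∣n = ⊥-elim (ℕ.<⇒≱ ∣i∣<p (ℕ.∣⇒≤ p∣n))

0^n≡0 : ∀ {n} → 0 < n → 0ℤ ^ n ≡ 0ℤ
0^n≡0 {suc _} _ = refl

module Fermat {p} (isPrime : Prime p) where

  open Congruence (+ p)

  private
    [1+x]^p≈1+x^p : ∀ x → (1ℤ + x) ^ p ≈ 1ℤ + x ^ p
    [1+x]^p≈1+x^p x = mod (freshmans-dream isPrime x)

    z^p≈z-pred : ∀ x → (1ℤ + x) ^ p ≈ 1ℤ + x → x ^ p ≈ x
    z^p≈z-pred x eq = +-cancelˡ {1ℤ} (≈-trans (≈-sym ([1+x]^p≈1+x^p x)) eq)

  z^p≈z : ∀ z → z ^ p ≈ z
  z^p≈z (+ zero)     = ≈-reflexive (0^n≡0 (ℕ.>-nonZero⁻¹ p {{prime⇒nonZero isPrime}}))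
  z^p≈z (+ suc n)    = ≈-trans ([1+x]^p≈1+x^p (+ n)) (+-cong (≈-refl {1ℤ}) (z^p≈z (+ n)))
  z^p≈z -[1+ zero ]  = z^p≈z-pred -1ℤ (z^p≈z 0ℤ)
  z^p≈z -[1+ suc n ] = z^p≈z-pred -[1+ suc n ] (z^p≈z -[1+ n ])

  private
    p∣∣z∣*∣z^[p∸1]-1∣ : ∀ z → p ℕ.∣ ∣ z ∣ ℕ.* ∣ z ^ (p ∸ 1) - 1ℤ ∣
    p∣∣z∣*∣z^[p∸1]-1∣ z = subst (p ℕ.∣_) (ℤ.abs-* z _)
      (∣⇒∣ᵤ (subst (+ p ∣ˢ_) (trans (cong (λ e → z ^ e - z) (sym (ℕ.suc-pred p))) (factor z _))
                   (_≈_.divides (z^p≈z z))))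
      where
      instance _ = prime⇒nonZero isPrime
      factor : ∀ z w → z * w - z ≡ z * (w - 1ℤ)
      factor = solve-∀

  fermat : ∀ z → ¬ (+ p ∣ˢ z) → z ^ (p ∸ 1) ≈ 1ℤ
  fermat z p∤z with euclidsLemma ∣ z ∣ ∣ z ^ (p ∸ 1) - 1ℤ ∣ isPrime (p∣∣z∣*∣z^[p∸1]-1∣ z)
  ... | inj₁ p∣z = contradiction (∣ᵤ⇒∣ p∣z) p∤z
  ... | inj₂ p∣w = mod (∣ᵤ⇒∣ p∣w)

  z^[p∸1]≈1 : ∀ {z} → z ≢ 0ℤ → ∣ z ∣ < p → z ^ (p ∸ 1) ≈ 1ℤ
  z^[p∸1]≈1 {z} z≢0 ∣z∣<p = fermat z (z≢0 ∘ ∣i∣<p∧p∣i⇒i≡0 ∣z∣<p)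

  1-z^[p∸1]≈0 : ∀ {z} → z ≢ 0ℤ → ∣ z ∣ < p → 1ℤ - z ^ (p ∸ 1) ≈ 0ℤ
  1-z^[p∸1]≈0 z≢0 ∣z∣<p = +-cong (≈-refl {1ℤ}) (-‿cong (z^[p∸1]≈1 z≢0 ∣z∣<p))

  z^[p∸1]-1≈0 : ∀ {z} → z ≢ 0ℤ → ∣ z ∣ < p → z ^ (p ∸ 1) - 1ℤ ≈ 0ℤ
  z^[p∸1]-1≈0 z≢0 ∣z∣<p = +-cong (z^[p∸1]≈1 z≢0 ∣z∣<p) (≈-refl { -1ℤ})

∣[+m]-[+n]∣<p : ∀ {m n p} → m < p → n < p → ∣ + m - + n ∣ < p
∣[+m]-[+n]∣<p {m} {n} m<p n<p = ℕ.≤-<-trans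
  (subst (ℕ._≤ m ℕ.⊔ n) (cong ∣_∣ (sym (ℤ.[+m]-[+n]≡m⊖n m n))) (ℤ.∣m⊝n∣≤m⊔n m n))
  (ℕ.⊔-lub m<p n<p)

[+m]-[+n]≡+[m∸n] : ∀ {m n} → n ≤ m → + m - + n ≡ + (m ∸ n)
[+m]-[+n]≡+[m∸n] {m} {n} n≤m = trans (ℤ.[+m]-[+n]≡m⊖n m n) (ℤ.⊖-≥ n≤m)

[+m]-[+n]≢0 : ∀ {m n} → m ≢ n → + m - + n ≢ 0ℤ
[+m]-[+n]≢0 m≢n eq = m≢n (ℤ.+-injective (ℤ.i-j≡0⇒i≡j _ _ eq))

-- Digit expansions in base p

partialValue : ℕ → (ℕ → ℤ) → ℕ → ℤ
partialValue p x n = sumℤ n (λ i → x i * (+ p) ^ i)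

-- The digits of x after the carry c i has entered position i and c (suc i) has left it.
carryDigits : ℕ → (ℕ → ℤ) → (ℕ → ℤ) → ℕ → ℤ
carryDigits p x c i = x i + c i - + p * c (suc i)

partialValue-carryDigits : ∀ p x c → c 0 ≡ 0ℤ → ∀ n →
  partialValue p x n ≡ partialValue p (carryDigits p x c) n + c n * (+ p) ^ n
partialValue-carryDigits p x c c₀ zero    = sym (cong (λ c → 0ℤ + c * 1ℤ) c₀)
partialValue-carryDigits p x c c₀ (suc n) =
  trans (cong (_+ x n * (+ p) ^ n) (partialValue-carryDigits p x c c₀ n))
        (shift (partialValue p (carryDigits p x c) n) (x n) (c n) (c (suc n)) ((+ p) ^ n) (+ p))
  where shift : ∀ S x c c′ Q P → (S + c * Q) + x * Q ≡ (S + (x + c - P * c′) * Q) + c′ * (P * Q)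
        shift = solve-∀

carryDigits-sameP-adic : ∀ p x c → c 0 ≡ 0ℤ → SameP-adic p x (carryDigits p x c)
carryDigits-sameP-adic p x c c₀ n =
  ∣⇒∣ᵤ (subst ((+ p) ^ n ∣ˢ_) (sym difference) (∣.∣n⇒∣m*n (c n) ∣.∣-refl))
  where
  difference : partialValue p x n - partialValue p (carryDigits p x c) n ≡ c n * (+ p) ^ n
  difference = trans (cong (_- partialValue p (carryDigits p x c) n) (partialValue-carryDigits p x c c₀ n))
                     (cancel (partialValue p (carryDigits p x c) n) (c n * (+ p) ^ n))
    where cancel : ∀ S T → (S + T) - S ≡ T
          cancel = solve-∀

sameP-adic-sym : ∀ {p x y} → SameP-adic p x y → SameP-adic p y x
sameP-adic-sym {p} {x} {y} x~y n =
  ∣⇒∣ᵤ (subst ((+ p) ^ n ∣ˢ_) (negate (partialValue p x n) (partialValue p y n))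
              (∣.∣m⇒∣-m {m = partialValue p x n - partialValue p y n} (∣ᵤ⇒∣ (x~y n))))
  where negate : ∀ X Y → - (X - Y) ≡ Y - X
        negate = solve-∀

sameP-adic-trans : ∀ {p x y z} → SameP-adic p x y → SameP-adic p y z → SameP-adic p x z
sameP-adic-trans {p} {x} {y} {z} x~y y~z n =
  ∣⇒∣ᵤ (subst ((+ p) ^ n ∣ˢ_) (telescope (partialValue p x n) (partialValue p y n) (partialValue p z n))
              (∣.∣m∣n⇒∣m+n {m = partialValue p x n - partialValue p y n} (∣ᵤ⇒∣ (x~y n)) (∣ᵤ⇒∣ (y~z n))))
  where telescope : ∀ X Y Z → (X - Y) + (Y - Z) ≡ X - Z
        telescope = solve-∀

sameP-adic⇒≡ : ∀ {p x y} → (∀ i → ∣ x i - y i ∣ < p) → SameP-adic p x y → ∀ i → x i ≡ y i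
sameP-adic⇒≡ {p} {x} {y} close x~y = <-rec _ digit-eq
  where
  p^i≢0 : ∀ i → (+ p) ^ i ≢ 0ℤ
  p^i≢0 i eq with ℤ.i^n≡0⇒i≡0 (+ p) i eq | close 0
  ... | refl | ()
  digit-eq : ∀ i → (∀ {k} → k < i → x k ≡ y k) → x i ≡ y i
  digit-eq i below = ℤ.i-j≡0⇒i≡j _ _ (∣i∣<p∧p∣i⇒i≡0 (close i) p∣xᵢ-yᵢ)
    where
    last-digit : partialValue p x (suc i) - partialValue p y (suc i) ≡ (x i - y i) * (+ p) ^ i
    last-digit = trans
      (cong (λ S → (S + x i * (+ p) ^ i) - (partialValue p y (suc i)))
            (sumℤ-cong i (λ k k<i → cong (_* (+ p) ^ k) (below k<i))))
      (cancel (partialValue p y i) (x i) (y i) ((+ p) ^ i))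
      where cancel : ∀ S u v Q → (S + u * Q) - (S + v * Q) ≡ (u - v) * Q
            cancel = solve-∀
    p∣xᵢ-yᵢ : + p ∣ˢ x i - y i
    p∣xᵢ-yᵢ = ∣.*-cancelʳ-∣ ((+ p) ^ i) {{ℤ.≢-nonZero (p^i≢0 i)}}
                (subst (+ p * (+ p) ^ i ∣ˢ_) last-digit (∣ᵤ⇒∣ (x~y (suc i))))

carryDigits-unique : ∀ p x c {z} → c 0 ≡ 0ℤ → SameP-adic p x z → (∀ i → ∣ carryDigits p x c i - z i ∣ < p) →
                     ∀ i → carryDigits p x c i ≡ z i
carryDigits-unique p x c {z} c₀ x~z close = sameP-adic⇒≡ close
  (sameP-adic-trans {x = carryDigits p x c} {y = x} {z = z}
    (sameP-adic-sym {x = x} {y = carryDigits p x c} (carryDigits-sameP-adic p x c c₀)) x~z)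

n+n≡n*2 : ∀ n → n ℕ.+ n ≡ n ℕ.* 2
n+n≡n*2 n = trans (cong (n ℕ.+_) (sym (ℕ.+-identityʳ n))) (ℕ.*-comm 2 n)

prime≥3⇒odd : ∀ {p} → Prime p → 3 ≤ p → ∃[ h ] p ≡ suc (h ℕ.+ h)
prime≥3⇒odd {p} isPrime 3≤p with p % 2 | m%n<n p 2 | m≡m%n+[m/n]*n p 2
... | 0 | _ | p≡2q with prime⇒irreducible isPrime (ℕ.divides (p / 2) p≡2q)
...   | inj₁ ()
...   | inj₂ 2≡p = contradiction 2≡p (ℕ.<⇒≢ 3≤p)
prime≥3⇒odd {p} isPrime 3≤p | 1 | _ | p≡1+2q = p / 2 , trans p≡1+2q (cong suc (sym (n+n≡n*2 (p / 2))))
prime≥3⇒odd {p} isPrime 3≤p | suc (suc _) | s≤s (s≤s ()) | _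

-- Balanced and standard digits modulo an odd prime p = 2h + 1

module OddPrime (h : ℕ) (isPrime : Prime (suc (h ℕ.+ h))) where

  p : ℕ
  p = suc (h ℕ.+ h)

  open Congruence (+ p)
  open Fermat isPrime

  0<h+h : 0 < h ℕ.+ h
  0<h+h = ℕ.≤-pred (ℕ.nonTrivial⇒n>1 p {{prime⇒nonTrivial isPrime}})

  0^[h+h]≡0 : 0ℤ ^ (h ℕ.+ h) ≡ 0ℤ
  0^[h+h]≡0 = 0^n≡0 0<h+h

  ≤h⇒<p : ∀ {n} → n ≤ h → n < p
  ≤h⇒<p n≤h = s≤s (ℕ.≤-trans n≤h (ℕ.m≤m+n h h))

  +≤h⇒<p : ∀ {m n} → m ≤ h → n ≤ h → m ℕ.+ n < p
  +≤h⇒<p m≤h n≤h = s≤s (ℕ.+-mono-≤ m≤h n≤h)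

  Qᶠ : ℤ → ℤ
  Qᶠ x = 1ℤ - x ^ (h ℕ.+ h)

  Fᶠ : ℤ → ℤ
  Fᶠ x = sumℤ h (λ k → (x + + suc k) ^ (h ℕ.+ h) - 1ℤ)

  borrowStep : ℤ → ℤ → ℤ
  borrowStep (+ zero)  c = c
  borrowStep +[1+ _ ]  c = 0ℤ
  borrowStep -[1+ _ ]  c = -1ℤ

  -- The carry (0 or -1) into position t when balanced digits a are rewritten as standard ones.
  borrow : (ℕ → ℤ) → ℕ → ℤ
  borrow a zero    = 0ℤ
  borrow a (suc t) = borrowStep (a t) (borrow a t)

  Fᶠ-nonneg : ∀ {m} → m ≤ h → Fᶠ (+ m) ≈ 0ℤ
  Fᶠ-nonneg {m} m≤h =
    sumℤ-≈-0 h (λ k k<h → z^[p∸1]-1≈0 (ℕ.m+1+n≢0 m ∘ ℤ.+-injective) (+≤h⇒<p m≤h k<h))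

  -- -[1+ m ] + + suc k and + suc k - + suc m both reduce to suc k ⊖ suc m.
  Fᶠ-neg : ∀ {m} → m < h → Fᶠ -[1+ m ] ≈ -1ℤ
  Fᶠ-neg {m} m<h = sumℤ-≈-single h m<h
    (≈-reflexive (trans (cong (λ z → z ^ (h ℕ.+ h) - 1ℤ) (ℤ.n⊖n≡0 (suc m))) (cong (_- 1ℤ) 0^[h+h]≡0)))
    (λ k k<h k≢m → z^[p∸1]-1≈0 ([+m]-[+n]≢0 (k≢m ∘ ℕ.suc-injective))
                               (∣[+m]-[+n]∣<p (≤h⇒<p k<h) (≤h⇒<p m<h)))

  borrowStep≈ : ∀ {x} c → ∣ x ∣ ≤ h → borrowStep x c ≈ c * Qᶠ x + Fᶠ x
  borrowStep≈ {+ zero}    c _     = ≈-sym (≈-trans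
    (+-cong (*-cong (≈-refl {c}) (≈-reflexive (cong (λ z → 1ℤ - z) 0^[h+h]≡0))) (Fᶠ-nonneg z≤n))
    (≈-reflexive (trans (ℤ.+-identityʳ (c * 1ℤ)) (ℤ.*-identityʳ c))))
  borrowStep≈ {+[1+ m ]}  c ∣x∣≤h = ≈-sym (≈-trans
    (+-cong (*-cong (≈-refl {c}) (1-z^[p∸1]≈0 (λ ()) (≤h⇒<p ∣x∣≤h))) (Fᶠ-nonneg ∣x∣≤h))
    (≈-reflexive (cong (_+ 0ℤ) (ℤ.*-zeroʳ c))))
  borrowStep≈ { -[1+ m ]} c ∣x∣≤h = ≈-sym (≈-trans
    (+-cong (*-cong (≈-refl {c}) (1-z^[p∸1]≈0 (λ ()) (≤h⇒<p ∣x∣≤h))) (Fᶠ-neg ∣x∣≤h))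
    (≈-reflexive (cong (_+ -1ℤ) (ℤ.*-zeroʳ c))))

  half≡h : half p ≡ h
  half≡h = trans (cong (ℕ._/ 2) (n+n≡n*2 h)) (m*n/n≡m h 2)

  f≡iterAffine : ∀ t x → f p t x ≡ iterAffine t (Fᶠ ∘ x) (Qᶠ ∘ x)
  f≡iterAffine t x =
    cong (λ H → iterAffine t (λ l → sumFromTo 1 H (λ c → (x l + + c) ^ (h ℕ.+ h) - 1ℤ)) (Qᶠ ∘ x)) half≡h

  f≈borrow : ∀ {a} → (∀ i → ∣ a i ∣ ≤ h) → ∀ t → f p t a ≈ borrow a t
  f≈borrow {a} balanced t = ≈-trans (≈-reflexive (f≡iterAffine t a))
    (iterAffine-≈ (borrow a) (Fᶠ ∘ a) (Qᶠ ∘ a) refl (λ s → borrowStep≈ (borrow a s) (balanced s)) t)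

  borrow∈ : ∀ a t → borrow a t ≡ 0ℤ ⊎ borrow a t ≡ -1ℤ
  borrow∈ a zero    = inj₁ refl
  borrow∈ a (suc t) with a t | borrow∈ a t
  ... | + zero   | c∈ = c∈
  ... | +[1+ _ ] | _  = inj₁ refl
  ... | -[1+ _ ] | _  = inj₂ refl

  borrowStep-standard : ∀ x {c} → ∣ x ∣ ≤ h → c ≡ 0ℤ ⊎ c ≡ -1ℤ →
                        ∃[ n ] n < p × x + c - + p * borrowStep x c ≡ + n
  borrowStep-standard (+ zero)    _    (inj₁ refl) = 0 , s≤s z≤n , E (+ p)
    where E : ∀ P → 0ℤ + 0ℤ - P * 0ℤ ≡ 0ℤ
          E = solve-∀
  borrowStep-standard (+ zero)    _    (inj₂ refl) = h ℕ.+ h , ℕ.≤-refl , E (+ (h ℕ.+ h))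
    where E : ∀ X → 0ℤ + -1ℤ - (1ℤ + X) * -1ℤ ≡ X
          E = solve-∀
  borrowStep-standard (+[1+ m ])  m<h  (inj₁ refl) = suc m , ≤h⇒<p m<h , E (+ suc m) (+ p)
    where E : ∀ X P → X + 0ℤ - P * 0ℤ ≡ X
          E = solve-∀
  borrowStep-standard (+[1+ m ])  m<h  (inj₂ refl) = m , ≤h⇒<p (ℕ.<⇒≤ m<h) , E (+ m) (+ p)
    where E : ∀ M P → (1ℤ + M) + -1ℤ - P * 0ℤ ≡ M
          E = solve-∀
  borrowStep-standard (-[1+ m ]) m<h  (inj₁ refl) = h ℕ.+ h ∸ m , s≤s (ℕ.m∸n≤m _ m) ,
    trans (E (+ m) (+ p)) ([+m]-[+n]≡+[m∸n] (ℕ.<⇒≤ (≤h⇒<p m<h)))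
    where E : ∀ M P → - (1ℤ + M) + 0ℤ - P * -1ℤ ≡ P - (1ℤ + M)
          E = solve-∀
  borrowStep-standard (-[1+ m ]) m<h  (inj₂ refl) = h ℕ.+ h ∸ suc m , s≤s (ℕ.m∸n≤m _ (suc m)) ,
    trans (E (+ m) (+ p)) ([+m]-[+n]≡+[m∸n] (≤h⇒<p m<h))
    where E : ∀ M P → - (1ℤ + M) + -1ℤ - P * -1ℤ ≡ P - (1ℤ + (1ℤ + M))
          E = solve-∀

  balanced⇒standard : ∀ a b → (∀ i → ∣ a i ∣ ≤ h) → (∀ j → b j < p) → SameP-adic p a (+_ ∘ b) →
                      ∀ t → + b t ≈ a t + f p t a
  balanced⇒standard a b balanced b<p a~b t = begin
    + b t                                      ≡⟨ sym (digits t) ⟩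
    a t + borrow a t - + p * borrow a (suc t)  ≈⟨ -multiple (a t + borrow a t) (borrow a (suc t)) ⟩
    a t + borrow a t                           ≈⟨ +-cong (≈-refl {a t}) (≈-sym (f≈borrow balanced t)) ⟩
    a t + f p t a                              ∎
    where
    open import Relation.Binary.Reasoning.Setoid ≈-setoid
    β = carryDigits p a (borrow a)
    close : ∀ i → ∣ β i - + b i ∣ < p
    close i with borrowStep-standard (a i) (balanced i) (borrow∈ a i)
    ... | n , n<p , eq = subst (λ z → ∣ z - + b i ∣ < p) (sym eq) (∣[+m]-[+n]∣<p n<p (b<p i))
    digits : ∀ i → β i ≡ + b i
    digits = carryDigits-unique p a (borrow a) refl a~b close

  Qᵍ : ℤ → ℤ
  Qᵍ y = 1ℤ - (y - + h) ^ (h ℕ.+ h)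

  Gᵍ : ℤ → ℤ
  Gᵍ y = sumℤ h (λ k → 1ℤ - (y - + (suc h ℕ.+ k)) ^ (h ℕ.+ h))

  carryStep : ℕ → ℤ → ℤ
  carryStep b c with ℕ.<-cmp b h
  ... | tri< _ _ _ = 0ℤ
  ... | tri≈ _ _ _ = c
  ... | tri> _ _ _ = 1ℤ

  -- The carry (0 or 1) into position t when standard digits b are rewritten as balanced ones.
  carry : (ℕ → ℕ) → ℕ → ℤ
  carry b zero    = 0ℤ
  carry b (suc t) = carryStep (b t) (carry b t)

  1+h+k<p : ∀ {k} → k < h → suc h ℕ.+ k < p
  1+h+k<p k<h = s≤s (ℕ.+-monoʳ-< h k<h)

  1-[m-n]^[h+h]≈0 : ∀ {m n} → m ≢ n → m < p → n < p → 1ℤ - (+ m - + n) ^ (h ℕ.+ h) ≈ 0ℤ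
  1-[m-n]^[h+h]≈0 m≢n m<p n<p = 1-z^[p∸1]≈0 ([+m]-[+n]≢0 m≢n) (∣[+m]-[+n]∣<p m<p n<p)

  1-[n-n]^[h+h]≡1 : ∀ n → 1ℤ - (+ n - + n) ^ (h ℕ.+ h) ≡ 1ℤ
  1-[n-n]^[h+h]≡1 n =
    trans (cong (λ z → 1ℤ - z ^ (h ℕ.+ h)) (ℤ.+-inverseʳ (+ n))) (cong (λ z → 1ℤ - z) 0^[h+h]≡0)

  Gᵍ-≤ : ∀ {b} → b ≤ h → Gᵍ (+ b) ≈ 0ℤ
  Gᵍ-≤ b≤h = sumℤ-≈-0 h (λ k k<h →
    1-[m-n]^[h+h]≈0 (ℕ.<⇒≢ (s≤s (ℕ.≤-trans b≤h (ℕ.m≤m+n h k)))) (≤h⇒<p b≤h) (1+h+k<p k<h))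

  Gᵍ-> : ∀ {b} → h < b → b < p → Gᵍ (+ b) ≈ 1ℤ
  Gᵍ-> {b} h<b b<p = sumℤ-≈-single h j<h
    (≈-reflexive (subst (λ n → 1ℤ - (+ b - + n) ^ (h ℕ.+ h) ≡ 1ℤ) (sym 1+h+j≡b) (1-[n-n]^[h+h]≡1 b)))
    (λ k k<h k≢j → 1-[m-n]^[h+h]≈0
                     (λ b≡1+h+k → k≢j (sym (ℕ.+-cancelˡ-≡ (suc h) j k (trans 1+h+j≡b b≡1+h+k))))
                                     b<p (1+h+k<p k<h))
    where
    j = b ∸ suc h
    1+h+j≡b : suc h ℕ.+ j ≡ b
    1+h+j≡b = ℕ.m+[n∸m]≡n h<b
    j<h : j < h
    j<h = ℕ.+-cancelˡ-< (suc h) j h (subst (_≤ p) (cong suc (sym 1+h+j≡b)) b<p)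

  carryStep≈ : ∀ {b} c → b < p → carryStep b c ≈ c * Qᵍ (+ b) + Gᵍ (+ b)
  carryStep≈ {b} c b<p with ℕ.<-cmp b h
  ... | tri< b<h b≢h _ = ≈-sym (≈-trans
    (+-cong (*-cong (≈-refl {c}) (1-[m-n]^[h+h]≈0 b≢h b<p (≤h⇒<p ℕ.≤-refl))) (Gᵍ-≤ (ℕ.<⇒≤ b<h)))
    (≈-reflexive (cong (_+ 0ℤ) (ℤ.*-zeroʳ c))))
  ... | tri≈ _ refl _  = ≈-sym (≈-trans
    (+-cong (*-cong (≈-refl {c}) (≈-reflexive (1-[n-n]^[h+h]≡1 h))) (Gᵍ-≤ ℕ.≤-refl))
    (≈-reflexive (trans (ℤ.+-identityʳ (c * 1ℤ)) (ℤ.*-identityʳ c))))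
  ... | tri> _ b≢h h<b = ≈-sym (≈-trans
    (+-cong (*-cong (≈-refl {c}) (1-[m-n]^[h+h]≈0 b≢h b<p (≤h⇒<p ℕ.≤-refl))) (Gᵍ-> h<b b<p))
    (≈-reflexive (cong (_+ 1ℤ) (ℤ.*-zeroʳ c))))

  g≡iterAffine : ∀ t y → g p t y ≡ iterAffine t (Gᵍ ∘ y) (Qᵍ ∘ y)
  g≡iterAffine t y = trans
    (cong (λ H → iterAffine t (λ l → sumℤ (h ℕ.+ h ∸ H) (λ k → 1ℤ - (y l - + (suc H ℕ.+ k)) ^ (h ℕ.+ h)))
                              (λ i → 1ℤ - (y i - + H) ^ (h ℕ.+ h))) half≡h)
    (cong (λ n → iterAffine t (λ l → sumℤ n (λ k → 1ℤ - (y l - + (suc h ℕ.+ k)) ^ (h ℕ.+ h))) (Qᵍ ∘ y))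
          (ℕ.m+n∸m≡n h h))

  g≈carry : ∀ {b} → (∀ j → b j < p) → ∀ t → g p t (+_ ∘ b) ≈ carry b t
  g≈carry {b} b<p t = ≈-trans (≈-reflexive (g≡iterAffine t (+_ ∘ b)))
    (iterAffine-≈ (carry b) (Gᵍ ∘ +_ ∘ b) (Qᵍ ∘ +_ ∘ b) refl (λ s → carryStep≈ (carry b s) (b<p s)) t)

  carry∈ : ∀ b t → carry b t ≡ 0ℤ ⊎ carry b t ≡ 1ℤ
  carry∈ b zero    = inj₁ refl
  carry∈ b (suc t) with ℕ.<-cmp (b t) h
  ... | tri< _ _ _ = inj₁ refl
  ... | tri≈ _ _ _ = carry∈ b t
  ... | tri> _ _ _ = inj₂ refl

  ∣[+n]-p∣≤h : ∀ {n} → h < n → n ≤ p → ∣ + n - + p ∣ ≤ h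
  ∣[+n]-p∣≤h {n} h<n n≤p =
    subst (_≤ h) (sym ∣n-p∣≡p∸n) (subst (p ∸ n ≤_) (ℕ.m+n∸m≡n h h) (ℕ.∸-monoʳ-≤ p h<n))
    where ∣n-p∣≡p∸n : ∣ + n - + p ∣ ≡ p ∸ n
          ∣n-p∣≡p∸n = trans (ℤ.∣i-j∣≡∣j-i∣ (+ n) (+ p)) (cong ∣_∣ ([+m]-[+n]≡+[m∸n] n≤p))

  carryStep-balanced : ∀ b {c} → b < p → c ≡ 0ℤ ⊎ c ≡ 1ℤ → ∣ + b + c - + p * carryStep b c ∣ ≤ h
  carryStep-balanced b b<p c∈ with ℕ.<-cmp b h | c∈
  ... | tri< b<h _ _ | inj₁ refl = subst (λ z → ∣ z ∣ ≤ h) (sym (E (+ b) (+ p))) (ℕ.<⇒≤ b<h)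
    where E : ∀ B P → B + 0ℤ - P * 0ℤ ≡ B
          E = solve-∀
  ... | tri< b<h _ _ | inj₂ refl = subst (λ z → ∣ z ∣ ≤ h) (sym (E (+ b) (+ p))) b<h
    where E : ∀ B P → B + 1ℤ - P * 0ℤ ≡ 1ℤ + B
          E = solve-∀
  ... | tri≈ _ refl _ | inj₁ refl = subst (λ z → ∣ z ∣ ≤ h) (sym (E (+ h) (+ p))) ℕ.≤-refl
    where E : ∀ B P → B + 0ℤ - P * 0ℤ ≡ B
          E = solve-∀
  ... | tri≈ _ refl _ | inj₂ refl =
    subst (λ z → ∣ z ∣ ≤ h) (sym (E (+ h))) (ℕ.≤-reflexive (ℤ.∣-i∣≡∣i∣ (+ h)))
    where E : ∀ H → H + 1ℤ - (1ℤ + (H + H)) * 1ℤ ≡ - H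
          E = solve-∀
  ... | tri> _ _ h<b | inj₁ refl = subst (λ z → ∣ z ∣ ≤ h) (sym (E (+ b) (+ p))) (∣[+n]-p∣≤h h<b (ℕ.<⇒≤ b<p))
    where E : ∀ B P → B + 0ℤ - P * 1ℤ ≡ B - P
          E = solve-∀
  ... | tri> _ _ h<b | inj₂ refl =
    subst (λ z → ∣ z ∣ ≤ h) (sym (E (+ b) (+ p))) (∣[+n]-p∣≤h (ℕ.m<n⇒m<1+n h<b) b<p)
    where E : ∀ B P → B + 1ℤ - P * 1ℤ ≡ (1ℤ + B) - P
          E = solve-∀

  standard⇒balanced : ∀ a b → (∀ i → ∣ a i ∣ ≤ h) → (∀ j → b j < p) → SameP-adic p a (+_ ∘ b) →
                      ∀ t → a t ≈ + b t + g p t (+_ ∘ b)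
  standard⇒balanced a b balanced b<p a~b t = begin
    a t                                                ≡⟨ sym (digits t) ⟩
    + b t + carry b t - + p * carry b (suc t)          ≈⟨ -multiple (+ b t + carry b t) (carry b (suc t)) ⟩
    + b t + carry b t                                  ≈⟨ +-cong (≈-refl {+ b t}) (≈-sym (g≈carry b<p t)) ⟩
    + b t + g p t (+_ ∘ b)                             ∎
    where
    open import Relation.Binary.Reasoning.Setoid ≈-setoid
    α = carryDigits p (+_ ∘ b) (carry b)
    close : ∀ i → ∣ α i - a i ∣ < p
    close i = s≤s (ℕ.≤-trans (ℤ.∣i-j∣≤∣i∣+∣j∣ (α i) (a i))
                             (ℕ.+-mono-≤ (carryStep-balanced (b i) (b<p i) (carry∈ b i)) (balanced i)))
    digits : ∀ i → α i ≡ a i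
    digits = carryDigits-unique p (+_ ∘ b) (carry b) refl (sameP-adic-sym {x = a} {y = +_ ∘ b} a~b) close

theorem5p1 : (p : ℕ) → Prime p → 3 ≤ p →
    (a : ℕ → ℤ) → (∀ i → ∣ a i ∣ ≤ half p) →
    (b : ℕ → ℕ) → (∀ j → b j < p) →
    SameP-adic p a (λ j → + b j) →
    ∀ t → ((+ b t) ≡ a t + f p t a [mod + p ])
    × (a t ≡ (+ b t) + g p t (λ j → + b j) [mod + p ])
theorem5p1 p isPrime 3≤p a a-small b b<p a~b t with prime≥3⇒odd isPrime 3≤p
... | h , refl = ≈⇒≡[mod] (balanced⇒standard a b balanced b<p a~b t)
               , ≈⇒≡[mod] (standard⇒balanced a b balanced b<p a~b t)
  where
  open OddPrime h isPrime hiding (p)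
  open Congruence (+ suc (h ℕ.+ h))
  balanced : ∀ i → ∣ a i ∣ ≤ h
  balanced i = subst (∣ a i ∣ ≤_) half≡h (a-small i)
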